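{- Let $k\ge 1$, $n\ge 6$ and $T_{6k,n}=C_{6k}\Box C_n$. Then $\chi(T_{6k,n}^2)\le 6$.
   Context: $C_j$ denotes the cycle on $j$ vertices; $\Box$ is the Cartesian product of graphs. The square $G^2$ of a graph $G$ has vertex set $V(G)$, two distinct vertices being adjacent iff their distance in $G$ is at most 2. $\chi$ is the chromatic number. -}

module Defs where

open import Level using (0ℓ)
open import Data.Nat using (ℕ; suc; _+_; _%_; NonZero)
open import Data.Fin using (Fin; toℕ)
open import Data.Product using (_×_; Σ; ∃; ∃-syntax)
open import Data.Sum using (_⊎_)
open import Relation.Nullary using (¬_)
open import Relation.Binary.PropositionalEquality using (_≡_)

record Graph : Set₁ where
  field
    V   : Set
    Adj : V → V → Set

open Graph public

IsSucc : (m : ℕ) → Fin m → Fin m → Set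
IsSucc m i j = (toℕ j ≡ suc (toℕ i)) ⊎ ((suc (toℕ i) ≡ m) × (toℕ j ≡ 0))

-- The cycle C_m on vertex set Fin m: i ~ j iff j ≡ i+1 or i ≡ j+1 (mod m).
-- (Used only for m ≥ 3, where this is the usual simple cycle.)
Cycle : (m : ℕ) → Graph
Cycle m = record
  { V   = Fin m
  ; Adj = λ i j → IsSucc m i j ⊎ IsSucc m j i
  }

_□_ : Graph → Graph → Graph
G □ H = record
  { V   = V G × V H
  ; Adj = λ p q → (Data.Product.proj₁ p ≡ Data.Product.proj₁ q × Adj H (Data.Product.proj₂ p) (Data.Product.proj₂ q))
                ⊎ (Adj G (Data.Product.proj₁ p) (Data.Product.proj₁ q) × Data.Product.proj₂ p ≡ Data.Product.proj₂ q)
  }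

square : Graph → Graph
square G = record
  { V   = V G
  ; Adj = λ u v → ¬ (u ≡ v) × (Adj G u v ⊎ (∃[ w ] (Adj G u w × Adj G w v)))
  }

ProperColouring : Graph → ℕ → Set
ProperColouring G c = Σ (V G → Fin c) λ f → ∀ u v → Adj G u v → ¬ (f u ≡ f v)

χ≤ : Graph → ℕ → Set
χ≤ G c = ProperColouring G c

Torus : (m n : ℕ) → Graph
Torus m n = Cycle m □ Cycle n

module Submission where

-- Colour the vertex (i , j) of C_{6k} □ C_n by  i + h(j)  (mod 6),  where the
-- "height" h(j) = d₀ + … + d_{j-1} is the prefix sum of a sequence of column
-- steps d₀ , … , d_{n-1}.  Moving along a row changes the colour by ±1, moving
-- along a column by ±d_j.  If every step lies in {2, 3, 4}, cyclically
-- consecutive steps never add up to 0 (mod 6), and all steps together add up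
-- to 0 (mod 6) (so that the colouring closes up around the column cycle), then
-- every colour change along a walk of length 1 or 2 between distinct vertices
-- is non-zero mod 6, so the colouring is proper on the square of the torus.

open import Defs
open import Data.Nat using (ℕ; zero; suc; pred; _+_; _*_; _∸_; _%_; _≤_; s≤s; z≤n; NonZero)
open import Data.Nat.Properties
  using (+-assoc; +-comm; *-suc; suc-injective; suc-pred; <-irrefl; ≤-trans; m+[n∸m]≡n;
         +-commutativeSemigroup)
open import Data.Nat.DivMod using (%-distribˡ-+; %-remove-+ʳ; m%n<n; _mod_; _divMod_; DivMod)
open import Data.Nat.Divisibility using (m∣m*n)
open import Data.Nat.Solver using (module +-*-Solver)
open import Algebra.Properties.CommutativeSemigroup +-commutativeSemigroup using (x∙yz≈y∙xz)
open import Data.Fin using (Fin; toℕ) renaming (zero to fzero; suc to fsuc)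
open import Data.Fin.Properties using (toℕ-injective; toℕ<n; toℕ-fromℕ<)
open import Data.Product using (_×_; _,_)
open import Data.Sum using (inj₁; inj₂)
open import Function using (_∘_)
open import Relation.Nullary using (¬_)
open import Relation.Binary.PropositionalEquality
  using (_≡_; _≢_; refl; sym; trans; cong; cong₂; subst; ≢-sym; module ≡-Reasoning)

open ≡-Reasoning

module Residues (m : ℕ) .{{_ : NonZero m}} where

  infix 4 _≈_ _≉_

  _≈_ : ℕ → ℕ → Set
  a ≈ b = a % m ≡ b % m

  _≉_ : ℕ → ℕ → Set
  a ≉ b = ¬ (a ≈ b)

  +-congˡ : ∀ a {b c} → b ≈ c → a + b ≈ a + c
  +-congˡ a {b} {c} b≈c = begin
    (a + b) % m              ≡⟨ %-distribˡ-+ a b m ⟩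
    (a % m + b % m) % m      ≡⟨ cong (λ x → (a % m + x) % m) b≈c ⟩
    (a % m + c % m) % m      ≡⟨ %-distribˡ-+ a c m ⟨
    (a + c) % m              ∎

  +-congʳ : ∀ {a b} c → a ≈ b → a + c ≈ b + c
  +-congʳ {a} {b} c a≈b = begin
    (a + c) % m  ≡⟨ cong (_% m) (+-comm a c) ⟩
    (c + a) % m  ≡⟨ +-congˡ c a≈b ⟩
    (c + b) % m  ≡⟨ cong (_% m) (+-comm c b) ⟩
    (b + c) % m  ∎

  +-multiple : ∀ a k → a + m * k ≈ a
  +-multiple a k = %-remove-+ʳ a (m∣m*n k)

  -- Residues can be cancelled: add (m - 1) * c to both sides.
  +-cancelʳ : ∀ {a b} c → a + c ≈ b + c → a ≈ b
  +-cancelʳ {a} {b} c eq = begin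
    a % m                        ≡⟨ +-multiple a c ⟨
    (a + m * c) % m              ≡⟨ cong (_% m) (complete a) ⟩
    (a + c + pred m * c) % m     ≡⟨ +-congʳ (pred m * c) eq ⟩
    (b + c + pred m * c) % m     ≡⟨ cong (_% m) (complete b) ⟨
    (b + m * c) % m              ≡⟨ +-multiple b c ⟩
    b % m                        ∎
    where
    complete : ∀ x → x + m * c ≡ x + c + pred m * c
    complete x = begin
      x + m * c                ≡⟨ cong (λ y → x + y * c) (suc-pred m) ⟨
      x + (c + pred m * c)     ≡⟨ +-assoc x c (pred m * c) ⟨
      x + c + pred m * c       ∎

  -- "y is reached from x by adding b and subtracting a":  a + y ≈ b + x.
  -- Such shifts compose by adding the corresponding parts, in either order.
  record Shift (a b x y : ℕ) : Set where
    constructor shift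
    field shifted : a + y ≈ b + x

  shift-trans : ∀ {a b c e x y z} → Shift a b x y → Shift c e y z → Shift (a + c) (b + e) x z
  shift-trans {a} {b} {c} {e} {x} {y} {z} (shift xy) (shift yz) = shift (begin
    (a + c + z) % m      ≡⟨ cong (_% m) (+-assoc a c z) ⟩
    (a + (c + z)) % m    ≡⟨ +-congˡ a yz ⟩
    (a + (e + y)) % m    ≡⟨ cong (_% m) (x∙yz≈y∙xz a e y) ⟩
    (e + (a + y)) % m    ≡⟨ +-congˡ e xy ⟩
    (e + (b + x)) % m    ≡⟨ cong (_% m) (x∙yz≈y∙xz e b x) ⟩
    (b + (e + x)) % m    ≡⟨ cong (_% m) (+-assoc b e x) ⟨
    (b + e + x) % m      ∎)

  shift-trans′ : ∀ {a b c e x y z} → Shift a b x y → Shift c e y z → Shift (c + a) (e + b) x z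
  shift-trans′ {a} {b} {c} {e} {x} {z = z} xy yz = shift (begin
    (c + a + z) % m  ≡⟨ cong (λ s → (s + z) % m) (+-comm c a) ⟩
    (a + c + z) % m  ≡⟨ Shift.shifted (shift-trans xy yz) ⟩
    (b + e + x) % m  ≡⟨ cong (λ s → (s + x) % m) (+-comm b e) ⟩
    (e + b + x) % m  ∎)

  shift-sym : ∀ {a b x y} → Shift a b x y → Shift b a y x
  shift-sym (shift xy) = shift (sym xy)

  shift-trivial : ∀ {a b x y} → Shift a b x y → x ≈ y → a ≈ b
  shift-trivial {b = b} {y = y} (shift xy) x≈y = +-cancelʳ y (trans xy (+-congˡ b x≈y))

open Residues 6

module _ {m : ℕ} {i i' i'' : Fin m} where

  isSucc-injective : IsSucc m i i' → IsSucc m i'' i' → i ≡ i''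
  isSucc-injective (inj₁ e) (inj₁ e') = toℕ-injective (suc-injective (trans (sym e) e'))
  isSucc-injective (inj₁ e) (inj₂ (_ , e')) with () ← trans (sym e) e'
  isSucc-injective (inj₂ (_ , e)) (inj₁ e') with () ← trans (sym e') e
  isSucc-injective (inj₂ (a , _)) (inj₂ (a' , _)) = toℕ-injective (suc-injective (trans a (sym a')))

  isSucc-functional : IsSucc m i i' → IsSucc m i i'' → i' ≡ i''
  isSucc-functional (inj₁ e) (inj₁ e') = toℕ-injective (trans e (sym e'))
  isSucc-functional (inj₁ e) (inj₂ (a , _)) with () ← <-irrefl (trans e a) (toℕ<n i')
  isSucc-functional (inj₂ (a , _)) (inj₁ e') with () ← <-irrefl (trans e' a) (toℕ<n i'')
  isSucc-functional (inj₂ (_ , e)) (inj₂ (_ , e')) = toℕ-injective (trans e (sym e'))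

-- The admissible column steps 2, 3, 4.  An admissible step d is not congruent
-- to 0 or ±1 modulo 6, so 0, 1, d and 1 + d are pairwise incongruent.
data Admissible : ℕ → Set where
  two   : Admissible 2
  three : Admissible 3
  four  : Admissible 4

0≉1 : 0 ≉ 1
0≉1 ()

0≉2 : 0 ≉ 2
0≉2 ()

0≉d : ∀ {d} → Admissible d → 0 ≉ d
0≉d two   ()
0≉d three ()
0≉d four  ()

0≉1+d : ∀ {d} → Admissible d → 0 ≉ 1 + d
0≉1+d two   ()
0≉1+d three ()
0≉1+d four  ()

1≉d : ∀ {d} → Admissible d → 1 ≉ d
1≉d two   ()
1≉d three ()
1≉d four  ()

prefix : (ℕ → ℕ) → ℕ → ℕ
prefix d zero    = zero
prefix d (suc j) = d j + prefix d j

-- Column steps for the cycle C_n: each step is admissible, the two steps at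
-- either side of a vertex of C_n never sum to 0 (mod 6), and the total is 0
-- (mod 6), so that heights are well defined around the cycle.
record StepSequence (n : ℕ) : Set where
  field
    step       : ℕ → ℕ
    admissible : (j : Fin n) → Admissible (step (toℕ j))
    separated  : ∀ {j j' : Fin n} → IsSucc n j j' → step (toℕ j) + step (toℕ j') ≉ 0
    balanced   : prefix step n ≈ 0

module StepColouring (k : ℕ) {n : ℕ} (σ : StepSequence n) where

  open StepSequence σ

  Vertex : Set
  Vertex = Fin (6 * k) × Fin n

  height : Vertex → ℕ
  height (i , j) = toℕ i + prefix step (toℕ j)

  colour : Vertex → Fin 6
  colour u = height u mod 6

  record Offset (a b : ℕ) (u v : Vertex) : Set where
    constructor offset
    field shift-of : Shift a b (height u) (height v)

  _⨾_ : ∀ {a b c e u w v} → Offset a b u w → Offset c e w v → Offset (a + c) (b + e) u v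
  offset uw ⨾ offset wv = offset (shift-trans uw wv)

  _⨾′_ : ∀ {a b c e u w v} → Offset a b u w → Offset c e w v → Offset (c + a) (e + b) u v
  offset uw ⨾′ offset wv = offset (shift-trans′ uw wv)

  reverse : ∀ {a b u v} → Offset a b u v → Offset b a v u
  reverse (offset uv) = offset (shift-sym uv)

  same-colour : ∀ {u v} → colour u ≡ colour v → height u ≈ height v
  same-colour {u} {v} eq = begin
    height u % 6      ≡⟨ toℕ-fromℕ< (m%n<n (height u) 6) ⟨
    toℕ (colour u)    ≡⟨ cong toℕ eq ⟩
    toℕ (colour v)    ≡⟨ toℕ-fromℕ< (m%n<n (height v) 6) ⟩
    height v % 6      ∎

  apart : ∀ {a b u v} → a ≉ b → Offset a b u v → colour u ≢ colour v
  apart {u = u} {v} a≉b (offset uv) = a≉b ∘ shift-trivial uv ∘ same-colour {u} {v}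

  data Move : Vertex → Vertex → Set where
    right : ∀ {i i' j} → IsSucc (6 * k) i i' → Move (i , j) (i' , j)
    left  : ∀ {i i' j} → IsSucc (6 * k) i' i → Move (i , j) (i' , j)
    up    : ∀ {i j j'} → IsSucc n j j' → Move (i , j) (i , j')
    down  : ∀ {i j j'} → IsSucc n j' j → Move (i , j) (i , j')

  move : ∀ {u v} → Adj (Torus (6 * k) n) u v → Move u v
  move (inj₁ (refl , inj₁ s)) = up s
  move (inj₁ (refl , inj₂ s)) = down s
  move (inj₂ (inj₁ s , refl)) = right s
  move (inj₂ (inj₂ s , refl)) = left s

  -- A row step adds 1; wrapping around adds 6k ≡ 0.
  right-offset : ∀ {i i' j} → IsSucc (6 * k) i i' → Offset 0 1 (i , j) (i' , j)
  right-offset {j = j} (inj₁ i'≡1+i) = offset (shift (cong (λ x → (x + prefix step (toℕ j)) % 6) i'≡1+i))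
  right-offset {i} {i'} {j} (inj₂ (1+i≡6k , i'≡0)) = offset (shift (begin
    (toℕ i' + h) % 6        ≡⟨ cong (λ x → (x + h) % 6) i'≡0 ⟩
    h % 6                   ≡⟨ +-multiple h k ⟨
    (h + 6 * k) % 6         ≡⟨ cong (_% 6) (+-comm h (6 * k)) ⟩
    (6 * k + h) % 6         ≡⟨ cong (λ x → (x + h) % 6) 1+i≡6k ⟨
    (suc (toℕ i) + h) % 6   ∎))
    where h = prefix step (toℕ j)

  left-offset : ∀ {i i' j} → IsSucc (6 * k) i' i → Offset 1 0 (i , j) (i' , j)
  left-offset s = reverse (right-offset s)

  climb : ∀ i j → toℕ i + prefix step (suc (toℕ j)) ≡ step (toℕ j) + height (i , j)
  climb i j = x∙yz≈y∙xz (toℕ i) (step (toℕ j)) (prefix step (toℕ j))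

  -- A column step adds d_j; wrapping around adds the total, which is ≡ 0.
  up-offset : ∀ {i j j'} → IsSucc n j j' → Offset 0 (step (toℕ j)) (i , j) (i , j')
  up-offset {i} {j} {j'} (inj₁ j'≡1+j) = offset (shift (begin
    (toℕ i + prefix step (toℕ j')) % 6        ≡⟨ cong (λ x → (toℕ i + prefix step x) % 6) j'≡1+j ⟩
    (toℕ i + prefix step (suc (toℕ j))) % 6   ≡⟨ cong (_% 6) (climb i j) ⟩
    (step (toℕ j) + height (i , j)) % 6       ∎))
  up-offset {i} {j} {j'} (inj₂ (1+j≡n , j'≡0)) = offset (shift (begin
    (toℕ i + prefix step (toℕ j')) % 6        ≡⟨ cong (λ x → (toℕ i + prefix step x) % 6) j'≡0 ⟩
    (toℕ i + 0) % 6                           ≡⟨ +-congˡ (toℕ i) balanced ⟨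
    (toℕ i + prefix step n) % 6               ≡⟨ cong (λ x → (toℕ i + prefix step x) % 6) 1+j≡n ⟨
    (toℕ i + prefix step (suc (toℕ j))) % 6   ≡⟨ cong (_% 6) (climb i j) ⟩
    (step (toℕ j) + height (i , j)) % 6       ∎))

  down-offset : ∀ {i j j'} → IsSucc n j' j → Offset (step (toℕ j')) 0 (i , j) (i , j')
  down-offset s = reverse (up-offset s)

  lowering raising : ∀ {u v} → Move u v → ℕ
  lowering (right _)             = 0
  lowering (left _)              = 1
  lowering (up _)                = 0
  lowering (down {j' = j'} _)    = step (toℕ j')
  raising (right _)              = 1
  raising (left _)               = 0
  raising (up {j = j} _)         = step (toℕ j)
  raising (down _)               = 0

  move-offset : ∀ {u v} (μ : Move u v) → Offset (lowering μ) (raising μ) u v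
  move-offset (right s) = right-offset s
  move-offset (left s)  = left-offset s
  move-offset (up s)    = up-offset s
  move-offset (down s)  = down-offset s

  admissible-at : ∀ {j j'} → IsSucc n j j' → Admissible (step (toℕ j))
  admissible-at {j} _ = admissible j

  one-step : ∀ {u v} → Move u v → colour u ≢ colour v
  one-step μ = apart (nonzero μ) (move-offset μ)
    where
    nonzero : ∀ {u v} (μ : Move u v) → lowering μ ≉ raising μ
    nonzero (right _) = 0≉1
    nonzero (left _)  = ≢-sym 0≉1
    nonzero (up s)    = 0≉d (admissible-at s)
    nonzero (down s)  = ≢-sym (0≉d (admissible-at s))

  -- A walk of two moves: a back-and-forth walk returns to its start; otherwise
  -- the height changes by ±2 (two row moves), ±(1 ± d) (a row and a column
  -- move), or ±(d + d') for consecutive steps d, d' (two column moves).  The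
  -- composite offset is formed with _⨾_ or _⨾′_ so that it reduces to a pair
  -- of the numbers 0, 1, 2, d, 1 + d, or to consecutive steps in the order in
  -- which  separated  states them.
  two-steps : ∀ {u w v} → u ≢ v → Move u w → Move w v → colour u ≢ colour v
  two-steps u≢v (right s) (left t)  = λ _ → u≢v (cong₂ _,_ (isSucc-injective s t) refl)
  two-steps u≢v (left s)  (right t) = λ _ → u≢v (cong₂ _,_ (isSucc-functional s t) refl)
  two-steps u≢v (up s)    (down t)  = λ _ → u≢v (cong₂ _,_ refl (isSucc-injective s t))
  two-steps u≢v (down s)  (up t)    = λ _ → u≢v (cong₂ _,_ refl (isSucc-functional s t))
  two-steps _ μ@(right _) ν@(right _) = apart 0≉2 (move-offset μ ⨾ move-offset ν)
  two-steps _ μ@(left _)  ν@(left _)  = apart (≢-sym 0≉2) (move-offset μ ⨾ move-offset ν)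
  two-steps _ μ@(right _) ν@(up t)    = apart (0≉1+d (admissible-at t)) (move-offset μ ⨾ move-offset ν)
  two-steps _ μ@(right _) ν@(down t)  = apart (≢-sym (1≉d (admissible-at t))) (move-offset μ ⨾ move-offset ν)
  two-steps _ μ@(left _)  ν@(up t)    = apart (1≉d (admissible-at t)) (move-offset μ ⨾ move-offset ν)
  two-steps _ μ@(left _)  ν@(down t)  = apart (≢-sym (0≉1+d (admissible-at t))) (move-offset μ ⨾ move-offset ν)
  two-steps _ μ@(up s)    ν@(right _) = apart (0≉1+d (admissible-at s)) (move-offset μ ⨾′ move-offset ν)
  two-steps _ μ@(up s)    ν@(left _)  = apart (1≉d (admissible-at s)) (move-offset μ ⨾′ move-offset ν)
  two-steps _ μ@(down s)  ν@(right _) = apart (≢-sym (1≉d (admissible-at s))) (move-offset μ ⨾′ move-offset ν)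
  two-steps _ μ@(down s)  ν@(left _)  = apart (≢-sym (0≉1+d (admissible-at s))) (move-offset μ ⨾′ move-offset ν)
  two-steps _ μ@(up s)    ν@(up _)    = apart (≢-sym (separated s)) (move-offset μ ⨾ move-offset ν)
  two-steps _ μ@(down _)  ν@(down t)  = apart (separated t) (move-offset μ ⨾′ move-offset ν)

  proper : ∀ u v → Adj (square (Torus (6 * k) n)) u v → colour u ≢ colour v
  proper u v (_ , inj₁ uv)               = one-step (move uv)
  proper u v (u≢v , inj₂ (w , uw , wv))  = two-steps u≢v (move uw) (move wv)

step-sequence-colouring : ∀ k {n} → StepSequence n → χ≤ (square (Torus (6 * k) n)) 6
step-sequence-colouring k σ = colour , proper
  where open StepColouring k σ

-- For r ∈ {0, 1, 2} the steps start with
-- (2, 2, 2), (3, 4, 3) or (3, 2, 3) respectively and continue with 2, 2, ….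
-- On a cycle of length 3 + 3q + r the total is 2(3q + r) + 6, 10 or 8
-- respectively, i.e. 6q + 6, 6q + 12 or 6q + 12, which is ≡ 0 (mod 6).
standard : Fin 3 → ℕ → ℕ
standard _                    (suc (suc (suc _))) = 2
standard fzero                _                   = 2
standard (fsuc fzero)         1                   = 4
standard (fsuc fzero)         _                   = 3
standard (fsuc (fsuc fzero))  1                   = 2
standard (fsuc (fsuc fzero))  _                   = 3

standard-admissible : ∀ r j → Admissible (standard r j)
standard-admissible _                   (suc (suc (suc _))) = two
standard-admissible fzero               0 = two
standard-admissible fzero               1 = two
standard-admissible fzero               2 = two
standard-admissible (fsuc fzero)        0 = three
standard-admissible (fsuc fzero)        1 = four
standard-admissible (fsuc fzero)        2 = three
standard-admissible (fsuc (fsuc fzero)) 0 = three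
standard-admissible (fsuc (fsuc fzero)) 1 = two
standard-admissible (fsuc (fsuc fzero)) 2 = three

standard-consecutive : ∀ r j → standard r j + standard r (suc j) ≉ 0
standard-consecutive _                   (suc (suc (suc _))) ()
standard-consecutive fzero               0 ()
standard-consecutive fzero               1 ()
standard-consecutive fzero               2 ()
standard-consecutive (fsuc fzero)        0 ()
standard-consecutive (fsuc fzero)        1 ()
standard-consecutive (fsuc fzero)        2 ()
standard-consecutive (fsuc (fsuc fzero)) 0 ()
standard-consecutive (fsuc (fsuc fzero)) 1 ()
standard-consecutive (fsuc (fsuc fzero)) 2 ()

-- The last step is 2 (a tail step, or the last of (2, 2, 2) when n = 3) and
-- the first is 2 or 3, so they sum to 4 or 5.
standard-wrap : ∀ r q → standard r (2 + (toℕ r + q * 3)) + standard r 0 ≉ 0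
standard-wrap fzero               zero    ()
standard-wrap fzero               (suc _) ()
standard-wrap (fsuc fzero)        _       ()
standard-wrap (fsuc (fsuc fzero)) _       ()

prefix-standard : ∀ r x → prefix (standard r) (3 + x) ≡ 2 * x + prefix (standard r) 3
prefix-standard r zero    = refl
prefix-standard r (suc x) = begin
  2 + prefix (standard r) (3 + x)  ≡⟨ cong (2 +_) (prefix-standard r x) ⟩
  2 + (2 * x + p)                  ≡⟨ +-assoc 2 (2 * x) p ⟨
  2 + 2 * x + p                    ≡⟨ cong (_+ p) (*-suc 2 x) ⟨
  2 * suc x + p                    ∎
  where
  p : ℕ
  p = prefix (standard r) 3

standard-balanced : ∀ r q → prefix (standard r) (3 + (toℕ r + q * 3)) ≈ 0
standard-balanced r q = begin
  prefix (standard r) (3 + (toℕ r + q * 3)) % 6  ≡⟨ cong (_% 6) (prefix-standard r (toℕ r + q * 3)) ⟩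
  (2 * (toℕ r + q * 3) + p) % 6                  ≡⟨ cong (_% 6) (regroup (toℕ r) q p) ⟩
  (2 * toℕ r + p + 6 * q) % 6                    ≡⟨ +-multiple (2 * toℕ r + p) q ⟩
  (2 * toℕ r + p) % 6                            ≡⟨ head r ⟩
  0                                              ∎
  where
  open +-*-Solver
  p : ℕ
  p = prefix (standard r) 3
  regroup : ∀ a q p → 2 * (a + q * 3) + p ≡ 2 * a + p + 6 * q
  regroup = solve 3 (λ a q p → con 2 :* (a :+ q :* con 3) :+ p := con 2 :* a :+ p :+ con 6 :* q) refl
  head : ∀ r → 2 * toℕ r + prefix (standard r) 3 ≈ 0
  head fzero               = refl
  head (fsuc fzero)        = refl
  head (fsuc (fsuc fzero)) = refl

standard-sequence : ∀ r q → StepSequence (3 + (toℕ r + q * 3))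
standard-sequence r q = record
  { step       = standard r
  ; admissible = standard-admissible r ∘ toℕ
  ; separated  = separated
  ; balanced   = standard-balanced r q
  }
  where
  separated : ∀ {j j'} → IsSucc (3 + (toℕ r + q * 3)) j j' →
              standard r (toℕ j) + standard r (toℕ j') ≉ 0
  separated {j} (inj₁ j'≡1+j) rewrite j'≡1+j = standard-consecutive r (toℕ j)
  separated (inj₂ (1+j≡n , j'≡0)) rewrite suc-injective 1+j≡n | j'≡0 = standard-wrap r q

step-sequence : ∀ m → StepSequence (3 + m)
step-sequence m = subst (StepSequence ∘ (3 +_)) (sym property) (standard-sequence remainder quotient)
  where open DivMod (m divMod 3)

corollary6 : (k n : ℕ) → 1 ≤ k → 6 ≤ n →
    χ≤ (square (Torus (6 * k) n)) 6
corollary6 k n _ 6≤n =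
  subst (λ l → χ≤ (square (Torus (6 * k) l)) 6) (m+[n∸m]≡n 3≤n)
    (step-sequence-colouring k (step-sequence (n ∸ 3)))
  where
  3≤n : 3 ≤ n
  3≤n = ≤-trans (s≤s (s≤s (s≤s z≤n))) 6≤n
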